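{- Let $S$ be a finite commutative semigroup. For any $a\in S$, ${\rm D}_{\bar a}(S/\mathcal{H})\le\psi(a)+1$, where $\bar a$ is the image of $a$ under the canonical epimorphism $S\to S/\mathcal{H}$.
   Context: $S$ is written additively; $(a)=\{a\}\cup\{a+c:c\in S\}$; $a\,\mathcal{H}\,b$ iff $(a)=(b)$ (a congruence), $S/\mathcal H$ the quotient semigroup. $\psi(a)$ is the largest $\ell$ such that there exist $a_1,\dots,a_\ell\in S$ with $(a)\subsetneq(a_1)\subsetneq\cdots\subsetneq(a_\ell)$. For a sequence $T$ (finite unordered, repetition allowed) with sum $\sigma(T)$, $T$ is irreducible if no proper subsequence (including the empty one) has sum $\sigma(T)$. For a commutative semigroup $M$ and $b\in M$, ${\rm D}_b(M)$ is the largest $\ell$ such that some irreducible sequence over $M$ of length $\ell$ has sum $b$ ($0$ if $b$ is the identity of a monoid $M$). -}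

module Defs where

open import Data.Nat using (ℕ; suc; _≤_; _<_)
open import Data.Fin using (Fin)
open import Data.List using (List; []; _∷_; length)
open import Data.List.Relation.Binary.Sublist.Propositional using (_⊆_)
open import Data.Product using (Σ; ∃; _×_; _,_)
open import Data.Sum using (_⊎_)
open import Data.Unit using (⊤)
open import Relation.Nullary using (¬_)
open import Relation.Binary.PropositionalEquality using (_≡_)
open import Function.Bundles using (_↔_)
open import Algebra.Structures using (IsCommutativeSemigroup)

record FiniteCommSemigroup : Set₁ where
  field
    Carrier : Set
    _+_     : Carrier → Carrier → Carrier
    isCommutativeSemigroup : IsCommutativeSemigroup _≡_ _+_
    size    : ℕ
    finite  : Carrier ↔ Fin size

module Notions (S : FiniteCommSemigroup) where
  open FiniteCommSemigroup S

  _∈⟨_⟩ : Carrier → Carrier → Set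
  x ∈⟨ a ⟩ = (x ≡ a) ⊎ (∃ λ c → x ≡ a + c)

  _⊑_ : Carrier → Carrier → Set
  a ⊑ b = ∀ x → x ∈⟨ a ⟩ → x ∈⟨ b ⟩

  _⊏_ : Carrier → Carrier → Set
  a ⊏ b = (a ⊑ b) × ¬ (b ⊑ a)

  _H_ : Carrier → Carrier → Set
  a H b = (a ⊑ b) × (b ⊑ a)

  Chain : Carrier → List Carrier → Set
  Chain a []       = ⊤
  Chain a (b ∷ bs) = (a ⊏ b) × Chain b bs

  IsPsi : Carrier → ℕ → Set
  IsPsi a ℓ = (∃ λ bs → Chain a bs × length bs ≡ ℓ)
            × (∀ bs → Chain a bs → length bs ≤ ℓ)

  -- The quotient S/H is represented by representatives in Carrier, equality _H_
  -- (H is a congruence, so _+_ on representatives induces the quotient operation).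

  IsIdentityH : Carrier → Set
  IsIdentityH e = ∀ x → (e + x) H x

  σ⁺ : Carrier → List Carrier → Carrier
  σ⁺ x []       = x
  σ⁺ x (y ∷ ys) = x + σ⁺ y ys

  -- "σ(T) = b̄ in S/H"; the empty sequence has sum b̄ iff b̄ is the identity of S/H
  -- (if S/H has no identity, the empty sum equals nothing).
  SumIsH : List Carrier → Carrier → Set
  SumIsH []       b = IsIdentityH b
  SumIsH (x ∷ xs) b = σ⁺ x xs H b

  IrreducibleH : Carrier → List Carrier → Set
  IrreducibleH x xs = ∀ U → U ⊆ (x ∷ xs) → length U < length (x ∷ xs)
                        → ¬ SumIsH U (σ⁺ x xs)

{-# OPTIONS --safe #-}
module Submission where

-- Let x₁ ⋯ xₗ be irreducible over S/H with sum ā, and tᵢ = xᵢ + ⋯ + xₗ its suffix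
-- sums. Then (t₁) ⊆ (t₂) ⊆ ⋯ ⊆ (tₗ), and every inclusion is strict: (tᵢ₊₁) ⊆ (tᵢ)
-- would give tᵢ H tᵢ₊₁, so, H being a congruence, deleting xᵢ would leave a proper
-- subsequence with the same sum in S/H. Since t₁ H a, this is a chain of length
-- ℓ - 1 above a, whence ℓ - 1 ≤ ψ(a).

open import Defs
open import Data.Nat using (ℕ; suc; _≤_; _<_; s≤s)
open import Data.Nat.Properties using (≤-reflexive)
open import Data.List using (List; []; _∷_; length; foldr; _++_; [_])
open import Data.List.Properties using (++-assoc; foldr-∷ʳ; length-++-sucʳ)
open import Data.List.Relation.Binary.Sublist.Propositional using (_⊆_; ⊆-refl; _∷ʳ_)
open import Data.List.Relation.Binary.Sublist.Propositional.Properties using (++⁺)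
open import Data.Product using (_,_)
open import Data.Sum using (inj₁; inj₂)
open import Data.Unit using (tt)
open import Function using (_∘_)
open import Relation.Nullary using (¬_)
open import Relation.Binary.PropositionalEquality using (_≡_; refl; sym; cong; subst)
open import Algebra.Structures using (IsCommutativeSemigroup)

module _ (S : FiniteCommSemigroup) where
  open FiniteCommSemigroup S
  open Notions S
  open IsCommutativeSemigroup isCommutativeSemigroup using (assoc; comm)

  ⊑-trans : ∀ {a b c} → a ⊑ b → b ⊑ c → a ⊑ c
  ⊑-trans a⊑b b⊑c x = b⊑c x ∘ a⊑b x

  ∈⟨⟩-+ : ∀ {x a} c → x ∈⟨ a ⟩ → (x + c) ∈⟨ a ⟩
  ∈⟨⟩-+ c (inj₁ refl)      = inj₂ (c , refl)
  ∈⟨⟩-+ c (inj₂ (d , refl)) = inj₂ (d + c , assoc _ d c)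

  ∈⟨⟩⇒⊑ : ∀ {x a} → x ∈⟨ a ⟩ → x ⊑ a
  ∈⟨⟩⇒⊑ x∈a _ (inj₁ refl)      = x∈a
  ∈⟨⟩⇒⊑ x∈a _ (inj₂ (c , refl)) = ∈⟨⟩-+ c x∈a

  ⊑⇒∈⟨⟩ : ∀ {x a} → x ⊑ a → x ∈⟨ a ⟩
  ⊑⇒∈⟨⟩ x⊑a = x⊑a _ (inj₁ refl)

  +-monoʳ-⊑ : ∀ c {a b} → a ⊑ b → (c + a) ⊑ (c + b)
  +-monoʳ-⊑ c a⊑b with ⊑⇒∈⟨⟩ a⊑b
  ... | inj₁ refl      = ∈⟨⟩⇒⊑ (inj₁ refl)
  ... | inj₂ (d , refl) = ∈⟨⟩⇒⊑ (inj₂ (d , sym (assoc c _ d)))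

  x+t⊑t : ∀ x t → (x + t) ⊑ t
  x+t⊑t x t = ∈⟨⟩⇒⊑ (inj₂ (x , comm x t))

  foldr-monoʳ-⊑ : ∀ p {a b} → a ⊑ b → foldr _+_ a p ⊑ foldr _+_ b p
  foldr-monoʳ-⊑ []      a⊑b = a⊑b
  foldr-monoʳ-⊑ (c ∷ p) a⊑b = +-monoʳ-⊑ c (foldr-monoʳ-⊑ p a⊑b)

  Chain-extendˡ : ∀ {a b} bs → a ⊑ b → Chain b bs → Chain a bs
  Chain-extendˡ []      _   _                         = tt
  Chain-extendˡ (_ ∷ _) a⊑b ((b⊑c , c⋢b) , chain) =
    (⊑-trans a⊑b b⊑c , λ c⊑a → c⋢b (⊑-trans c⊑a a⊑b)) , chain

  σ⁺-++ : ∀ z zs y ys → σ⁺ z (zs ++ y ∷ ys) ≡ foldr _+_ (σ⁺ y ys) (z ∷ zs)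
  σ⁺-++ z []       y ys = refl
  σ⁺-++ z (w ∷ ws) y ys = cong (z +_) (σ⁺-++ w ws y ys)

  SumIsH-++ : ∀ p y ys {b} → foldr _+_ (σ⁺ y ys) p H b → SumIsH (p ++ y ∷ ys) b
  SumIsH-++ []       y ys sum≈b = sum≈b
  SumIsH-++ (z ∷ zs) y ys sum≈b rewrite σ⁺-++ z zs y ys = sum≈b

  -- IrreducibleH for p ++ x ∷ xs, with the sum bracketed so that the suffix sum σ⁺ x xs
  -- is visible; p is the part already passed while the chain is built.
  IrreducibleAfter : List Carrier → Carrier → List Carrier → Set
  IrreducibleAfter p x xs =
    ∀ U → U ⊆ p ++ x ∷ xs → length U < length (p ++ x ∷ xs)
        → ¬ SumIsH U (foldr _+_ (σ⁺ x xs) p)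

  IrreducibleAfter-∷ʳ : ∀ p x y ys →
    IrreducibleAfter p x (y ∷ ys) → IrreducibleAfter (p ++ [ x ]) y ys
  IrreducibleAfter-∷ʳ p x y ys irr U
    rewrite ++-assoc p [ x ] (y ∷ ys) | foldr-∷ʳ _+_ (σ⁺ y ys) x p = irr U

  suffix-⊏ : ∀ p x y ys → IrreducibleAfter p x (y ∷ ys) → σ⁺ x (y ∷ ys) ⊏ σ⁺ y ys
  suffix-⊏ p x y ys irr = x+t⊑t x t , t⋢x+t
    where
    t : Carrier
    t = σ⁺ y ys
    t⋢x+t : ¬ (t ⊑ (x + t))
    t⋢x+t t⊑x+t = irr (p ++ y ∷ ys) (++⁺ (⊆-refl {x = p}) (x ∷ʳ ⊆-refl))
      (≤-reflexive (sym (length-++-sucʳ p x (y ∷ ys))))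
      (SumIsH-++ p y ys (foldr-monoʳ-⊑ p t⊑x+t , foldr-monoʳ-⊑ p (x+t⊑t x t)))

  suffixSums : List Carrier → List Carrier
  suffixSums []       = []
  suffixSums (y ∷ ys) = σ⁺ y ys ∷ suffixSums ys

  length-suffixSums : ∀ xs → length (suffixSums xs) ≡ length xs
  length-suffixSums []       = refl
  length-suffixSums (_ ∷ ys) = cong suc (length-suffixSums ys)

  suffixSums-Chain : ∀ p x xs → IrreducibleAfter p x xs → Chain (σ⁺ x xs) (suffixSums xs)
  suffixSums-Chain p x []       _   = tt
  suffixSums-Chain p x (y ∷ ys) irr =
    suffix-⊏ p x y ys irr ,
    suffixSums-Chain (p ++ [ x ]) y ys (IrreducibleAfter-∷ʳ p x y ys irr)

lemma3p13 : (S : FiniteCommSemigroup) →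
    let open FiniteCommSemigroup S
        open Notions S
    in (a : Carrier) (ψa : ℕ) → IsPsi a ψa →
       (x : Carrier) (xs : List Carrier) →
       SumIsH (x ∷ xs) a → IrreducibleH x xs →
       length (x ∷ xs) ≤ suc ψa
lemma3p13 S a ψa (_ , maximal) x xs (_ , a⊑σ) irr =
  s≤s (subst (_≤ ψa) (length-suffixSums S xs) (maximal (suffixSums S xs) chain))
  where
  open Notions S using (Chain)
  chain : Chain a (suffixSums S xs)
  chain = Chain-extendˡ S (suffixSums S xs) a⊑σ (suffixSums-Chain S [] x xs irr)
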